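{- Let $\Sigma$ be an algebraic signature. Then (1) $\mathsf{e}\text{ - }\mathbf{EqHyp}_\Sigma$ is equivalent to the slice category $\mathsf{e}\text{ - }\mathbf{EqHyp}/R(\mathcal G^\Sigma)$; (2) there is a functor $W_\Sigma\colon\mathsf{e}\text{ - }\mathbf{EqHyp}_\Sigma\to\mathsf{e}\text{ - }\mathbf{EqHyp}$ forgetting the labelling which creates all colimits, pullbacks and equalizers.
   Context: For a set $X$, $X^\star$ is the set of finite words over $X$, $f^\star$ acts letterwise, $\{*\}^\star\cong\mathbb N$ via length. A hypergraph is $(E,V,s,t)$ with $s,t\colon E\to V^\star$; morphisms $(h,k)$ with $k^\star\circ s=s'\circ h$, $k^\star\circ t=t'\circ h$ (category $\mathbf{Hyp}$). A hypergraph with equivalence is $(E,V,Q,s,t,q)$ with $(E,V,s,t)$ a hypergraph and $q\colon V\to Q$ surjective; morphisms are triples $(h_E,h_V,h_Q)$ with $(h_E,h_V)$ a hypergraph morphism and $h_Q\circ q=q'\circ h_V$ (category $\mathbf{EqHyp}$); $T\colon\mathbf{EqHyp}\to\mathbf{Hyp}$ forgets $Q,q$. It is an e-hypergraph if for all edges $e,e'$ with $q^\star(s(e))=q^\star(s(e'))$ one has $q^\star(t(e))=q^\star(t(e'))$; $\mathsf{e}\text{ - }\mathbf{EqHyp}$ is the full subcategory of $\mathbf{EqHyp}$ on e-hypergraphs. For a hypergraph $\mathcal H=(E,V,s,t)$, $R(\mathcal H)=(E,V,1,s,t,!_V)$ with $1$ a singleton. Signature $\Sigma=(O_\Sigma,\mathsf{ar}_\Sigma\colon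 O_\Sigma\to\mathbb N)$; $\mathcal G^\Sigma=(O_\Sigma,\{*\},\mathsf{ar}_\Sigma,\gamma_1)$, $\gamma_1$ sending each operation to the word of length 1 (so $R(\mathcal G^\Sigma)$ is an e-hypergraph). $\mathbf{EqHyp}_\Sigma$: objects $(\mathcal H,l)$ with $\mathcal H\in\mathbf{EqHyp}$, $l\colon T(\mathcal H)\to\mathcal G^\Sigma$ in $\mathbf{Hyp}$; morphisms are $\mathbf{EqHyp}$-morphisms $h$ with $l=l'\circ T(h)$. $\mathsf{e}\text{ - }\mathbf{EqHyp}_\Sigma$ is its full subcategory on those $(\mathcal H,l)$ with $\mathcal H$ an e-hypergraph. -}

module Defs where

open import Level using (Level; _⊔_) renaming (suc to lsuc; zero to lzero)
open import Data.Nat using (ℕ)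
open import Data.Unit using (⊤; tt)
open import Data.List using (List; []; _∷_; map; replicate)
open import Data.List.Properties using (map-∘; map-id)
open import Data.Product using (Σ; ∃; _×_; _,_; proj₁; proj₂)
open import Relation.Binary.Structures using (IsEquivalence)
open import Relation.Binary.PropositionalEquality
  using (_≡_; refl; sym; trans; cong)

record Category (o ℓ e : Level) : Set (lsuc (o ⊔ ℓ ⊔ e)) where
  infixr 9 _∘_
  infix 4 _≈_ _⇒_
  field
    Obj : Set o
    _⇒_ : Obj → Obj → Set ℓ
    _≈_ : ∀ {A B} → A ⇒ B → A ⇒ B → Set e
    id  : ∀ {A} → A ⇒ A
    _∘_ : ∀ {A B C} → B ⇒ C → A ⇒ B → A ⇒ C
    equiv     : ∀ {A B} → IsEquivalence (_≈_ {A} {B})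
    ∘-resp-≈  : ∀ {A B C} {f h : B ⇒ C} {g i : A ⇒ B} →
                f ≈ h → g ≈ i → f ∘ g ≈ h ∘ i
    identityˡ : ∀ {A B} {f : A ⇒ B} → id ∘ f ≈ f
    identityʳ : ∀ {A B} {f : A ⇒ B} → f ∘ id ≈ f
    assoc     : ∀ {A B C D} {f : A ⇒ B} {g : B ⇒ C} {h : C ⇒ D} →
                (h ∘ g) ∘ f ≈ h ∘ (g ∘ f)

  ≈-refl : ∀ {A B} {f : A ⇒ B} → f ≈ f
  ≈-refl = IsEquivalence.refl equiv
  ≈-sym : ∀ {A B} {f g : A ⇒ B} → f ≈ g → g ≈ f
  ≈-sym = IsEquivalence.sym equiv
  ≈-trans : ∀ {A B} {f g h : A ⇒ B} → f ≈ g → g ≈ h → f ≈ h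
  ≈-trans = IsEquivalence.trans equiv

open Category

module _ {o ℓ e o′ ℓ′ e′ : Level} where
  record Functor (C : Category o ℓ e) (D : Category o′ ℓ′ e′)
         : Set (o ⊔ ℓ ⊔ e ⊔ o′ ⊔ ℓ′ ⊔ e′) where
    private
      module C = Category C
      module D = Category D
    field
      F₀ : C.Obj → D.Obj
      F₁ : ∀ {A B} → A C.⇒ B → F₀ A D.⇒ F₀ B
      identity     : ∀ {A} → F₁ (C.id {A}) D.≈ D.id
      homomorphism : ∀ {X Y Z} {f : X C.⇒ Y} {g : Y C.⇒ Z} →
                     F₁ (g C.∘ f) D.≈ F₁ g D.∘ F₁ f
      F-resp-≈     : ∀ {A B} {f g : A C.⇒ B} → f C.≈ g → F₁ f D.≈ F₁ g

open Functor

idF : ∀ {o ℓ e} {C : Category o ℓ e} → Functor C C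
idF {C = C} = record
  { F₀ = λ X → X ; F₁ = λ f → f
  ; identity = ≈-refl C ; homomorphism = ≈-refl C ; F-resp-≈ = λ p → p }

_∘F_ : ∀ {o ℓ e o′ ℓ′ e′ o″ ℓ″ e″}
         {C : Category o ℓ e} {D : Category o′ ℓ′ e′} {E : Category o″ ℓ″ e″} →
       Functor D E → Functor C D → Functor C E
_∘F_ {E = E} G F = record
  { F₀ = λ X → F₀ G (F₀ F X)
  ; F₁ = λ f → F₁ G (F₁ F f)
  ; identity = ≈-trans E (F-resp-≈ G (identity F)) (identity G)
  ; homomorphism = ≈-trans E (F-resp-≈ G (homomorphism F)) (homomorphism G)
  ; F-resp-≈ = λ p → F-resp-≈ G (F-resp-≈ F p) }

record NatIso {o ℓ e o′ ℓ′ e′} {C : Category o ℓ e} {D : Category o′ ℓ′ e′}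
              (F G : Functor C D) : Set (o ⊔ ℓ ⊔ ℓ′ ⊔ e′) where
  private
    module C = Category C
    module D = Category D
  field
    η    : ∀ X → F₀ F X D.⇒ F₀ G X
    η⁻¹  : ∀ X → F₀ G X D.⇒ F₀ F X
    iso₁ : ∀ X → η⁻¹ X D.∘ η X D.≈ D.id
    iso₂ : ∀ X → η X D.∘ η⁻¹ X D.≈ D.id
    natural : ∀ {X Y} (f : X C.⇒ Y) → η Y D.∘ F₁ F f D.≈ F₁ G f D.∘ η X

record Equivalence {o ℓ e o′ ℓ′ e′}
                   (C : Category o ℓ e) (D : Category o′ ℓ′ e′)
                   : Set (o ⊔ ℓ ⊔ e ⊔ o′ ⊔ ℓ′ ⊔ e′) where
  field
    F      : Functor C D
    G      : Functor D C
    unit   : NatIso (idF {C = C}) (G ∘F F)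
    counit : NatIso (F ∘F G) (idF {C = D})

FullSub : ∀ {o ℓ e p} (C : Category o ℓ e) → (Obj C → Set p) → Category (o ⊔ p) ℓ e
FullSub C P = record
  { Obj = Σ (Obj C) P
  ; _⇒_ = λ A B → _⇒_ C (proj₁ A) (proj₁ B)
  ; _≈_ = _≈_ C
  ; id = id C
  ; _∘_ = _∘_ C
  ; equiv = equiv C
  ; ∘-resp-≈ = ∘-resp-≈ C
  ; identityˡ = identityˡ C
  ; identityʳ = identityʳ C
  ; assoc = assoc C }

Slice : ∀ {o ℓ e} (C : Category o ℓ e) → Obj C → Category (o ⊔ ℓ) (ℓ ⊔ e) e
Slice C X = record
  { Obj = Σ (Obj C) (λ A → _⇒_ C A X)
  ; _⇒_ = λ A B → Σ (_⇒_ C (proj₁ A) (proj₁ B))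
                    (λ h → _≈_ C (_∘_ C (proj₂ B) h) (proj₂ A))
  ; _≈_ = λ f g → _≈_ C (proj₁ f) (proj₁ g)
  ; id = id C , identityʳ C
  ; _∘_ = λ {A} {B} {D} g f → _∘_ C (proj₁ g) (proj₁ f) ,
          ≈-trans C (≈-sym C (assoc C))
            (≈-trans C (∘-resp-≈ C (proj₂ g) (≈-refl C)) (proj₂ f))
  ; equiv = record { refl = ≈-refl C ; sym = ≈-sym C ; trans = ≈-trans C }
  ; ∘-resp-≈ = ∘-resp-≈ C
  ; identityˡ = identityˡ C
  ; identityʳ = identityʳ C
  ; assoc = assoc C }

module _ {o ℓ e : Level} (C : Category o ℓ e) where
  private module C = Category C

  record Cocone (J : Category lzero lzero lzero) (D : Functor J C)
         : Set (o ⊔ ℓ ⊔ e) where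
    field
      N  : C.Obj
      ψ  : ∀ j → F₀ D j C.⇒ N
      commute : ∀ {i j} (f : _⇒_ J i j) → ψ j C.∘ F₁ D f C.≈ ψ i

  IsColimit : {J : Category lzero lzero lzero} {D : Functor J C} →
              Cocone J D → Set (o ⊔ ℓ ⊔ e)
  IsColimit {J} {D} K = ∀ (K′ : Cocone J D) →
    Σ (Cocone.N K C.⇒ Cocone.N K′) λ u →
      (∀ j → u C.∘ Cocone.ψ K j C.≈ Cocone.ψ K′ j) ×
      (∀ u′ → (∀ j → u′ C.∘ Cocone.ψ K j C.≈ Cocone.ψ K′ j) → u′ C.≈ u)

  record Square {A B Z : C.Obj} (f : A C.⇒ Z) (g : B C.⇒ Z) : Set (o ⊔ ℓ ⊔ e) where
    field
      P  : C.Obj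
      p₁ : P C.⇒ A
      p₂ : P C.⇒ B
      commute : f C.∘ p₁ C.≈ g C.∘ p₂

  IsPullback : ∀ {A B Z} {f : A C.⇒ Z} {g : B C.⇒ Z} → Square f g → Set (o ⊔ ℓ ⊔ e)
  IsPullback {f = f} {g} S = ∀ (S′ : Square f g) →
    Σ (Square.P S′ C.⇒ Square.P S) λ u →
      (Square.p₁ S C.∘ u C.≈ Square.p₁ S′) ×
      (Square.p₂ S C.∘ u C.≈ Square.p₂ S′) ×
      (∀ u′ → Square.p₁ S C.∘ u′ C.≈ Square.p₁ S′ →
              Square.p₂ S C.∘ u′ C.≈ Square.p₂ S′ → u′ C.≈ u)

  record Fork {A B : C.Obj} (f g : A C.⇒ B) : Set (o ⊔ ℓ ⊔ e) where
    field
      Eo : C.Obj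
      ι  : Eo C.⇒ A
      commute : f C.∘ ι C.≈ g C.∘ ι

  IsEqualizer : ∀ {A B} {f g : A C.⇒ B} → Fork f g → Set (o ⊔ ℓ ⊔ e)
  IsEqualizer {f = f} {g} K = ∀ (K′ : Fork f g) →
    Σ (Fork.Eo K′ C.⇒ Fork.Eo K) λ u →
      (Fork.ι K C.∘ u C.≈ Fork.ι K′) ×
      (∀ u′ → Fork.ι K C.∘ u′ C.≈ Fork.ι K′ → u′ C.≈ u)

module _ {o ℓ e o′ ℓ′ e′ : Level} {C : Category o ℓ e} {D : Category o′ ℓ′ e′}
         (F : Functor C D) where
  private
    module C = Category C
    module D = Category D

  mapCocone : ∀ {J} {Dg : Functor J C} → Cocone C J Dg → Cocone D J (F ∘F Dg)
  mapCocone K = record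
    { N = F₀ F (Cocone.N K)
    ; ψ = λ j → F₁ F (Cocone.ψ K j)
    ; commute = λ f → D.≈-trans (D.≈-sym (homomorphism F))
                                (F-resp-≈ F (Cocone.commute K f)) }

  mapSquare : ∀ {A B Z} {f : A C.⇒ Z} {g : B C.⇒ Z} →
              Square C f g → Square D (F₁ F f) (F₁ F g)
  mapSquare S = record
    { P = F₀ F (Square.P S)
    ; p₁ = F₁ F (Square.p₁ S)
    ; p₂ = F₁ F (Square.p₂ S)
    ; commute = D.≈-trans (D.≈-sym (homomorphism F))
                  (D.≈-trans (F-resp-≈ F (Square.commute S)) (homomorphism F)) }

  mapFork : ∀ {A B} {f g : A C.⇒ B} → Fork C f g → Fork D (F₁ F f) (F₁ F g)
  mapFork K = record
    { Eo = F₀ F (Fork.Eo K)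
    ; ι = F₁ F (Fork.ι K)
    ; commute = D.≈-trans (D.≈-sym (homomorphism F))
                  (D.≈-trans (F-resp-≈ F (Fork.commute K)) (homomorphism F)) }

  CreatesColimitOf : {J : Category lzero lzero lzero} → Functor J C →
                     Set (o ⊔ ℓ ⊔ e ⊔ o′ ⊔ ℓ′ ⊔ e′)
  CreatesColimitOf {J} Dg =
    (∀ (K : Cocone C J Dg) → IsColimit D (mapCocone K) → IsColimit C K) ×
    (∀ (L : Cocone D J (F ∘F Dg)) → IsColimit D L →
       Σ (Cocone C J Dg) λ K → IsColimit C K × IsColimit D (mapCocone K))

  CreatesColimits : Set (lsuc lzero ⊔ o ⊔ ℓ ⊔ e ⊔ o′ ⊔ ℓ′ ⊔ e′)
  CreatesColimits = ∀ (J : Category lzero lzero lzero) (Dg : Functor J C) →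
                    CreatesColimitOf Dg

  CreatesPullbacks : Set (o ⊔ ℓ ⊔ e ⊔ o′ ⊔ ℓ′ ⊔ e′)
  CreatesPullbacks = ∀ {A B Z} (f : A C.⇒ Z) (g : B C.⇒ Z) →
    (∀ (S : Square C f g) → IsPullback D (mapSquare S) → IsPullback C S) ×
    (∀ (S′ : Square D (F₁ F f) (F₁ F g)) → IsPullback D S′ →
       Σ (Square C f g) λ S → IsPullback C S × IsPullback D (mapSquare S))

  CreatesEqualizers : Set (o ⊔ ℓ ⊔ e ⊔ o′ ⊔ ℓ′ ⊔ e′)
  CreatesEqualizers = ∀ {A B} (f g : A C.⇒ B) →
    (∀ (K : Fork C f g) → IsEqualizer D (mapFork K) → IsEqualizer C K) ×
    (∀ (K′ : Fork D (F₁ F f) (F₁ F g)) → IsEqualizer D K′ →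
       Σ (Fork C f g) λ K → IsEqualizer C K × IsEqualizer D (mapFork K))

-- Hypergraphs  (X⋆ is List X, f⋆ is map f)

record Hyp : Set₁ where
  field
    E V : Set
    s t : E → List V

record HypHom (H H′ : Hyp) : Set where
  private
    module H  = Hyp H
    module H′ = Hyp H′
  field
    hE : H.E → H′.E
    hV : H.V → H′.V
    s-comm : ∀ e → map hV (H.s e) ≡ H′.s (hE e)
    t-comm : ∀ e → map hV (H.t e) ≡ H′.t (hE e)

_≈Hyp_ : ∀ {H H′} → HypHom H H′ → HypHom H H′ → Set
f ≈Hyp g = (∀ e → HypHom.hE f e ≡ HypHom.hE g e) ×
           (∀ v → HypHom.hV f v ≡ HypHom.hV g v)

idHyp : ∀ {H} → HypHom H H
idHyp {H} = record
  { hE = λ e → e ; hV = λ v → v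
  ; s-comm = λ e → map-id (Hyp.s H e)
  ; t-comm = λ e → map-id (Hyp.t H e) }

_∘Hyp_ : ∀ {A B C} → HypHom B C → HypHom A B → HypHom A C
_∘Hyp_ {A} g f = record
  { hE = λ e → HypHom.hE g (HypHom.hE f e)
  ; hV = λ v → HypHom.hV g (HypHom.hV f v)
  ; s-comm = λ e → trans (map-∘ (Hyp.s A e))
      (trans (cong (map (HypHom.hV g)) (HypHom.s-comm f e))
             (HypHom.s-comm g (HypHom.hE f e)))
  ; t-comm = λ e → trans (map-∘ (Hyp.t A e))
      (trans (cong (map (HypHom.hV g)) (HypHom.t-comm f e))
             (HypHom.t-comm g (HypHom.hE f e))) }

record EqHyp : Set₁ where
  field
    E V Q : Set
    s t   : E → List V
    q     : V → Q
    q-surjective : ∀ y → ∃ λ x → q x ≡ y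

record EqHypHom (H H′ : EqHyp) : Set where
  private
    module H  = EqHyp H
    module H′ = EqHyp H′
  field
    hE : H.E → H′.E
    hV : H.V → H′.V
    hQ : H.Q → H′.Q
    s-comm : ∀ e → map hV (H.s e) ≡ H′.s (hE e)
    t-comm : ∀ e → map hV (H.t e) ≡ H′.t (hE e)
    q-comm : ∀ v → hQ (H.q v) ≡ H′.q (hV v)

_≈EqHyp_ : ∀ {H H′} → EqHypHom H H′ → EqHypHom H H′ → Set
f ≈EqHyp g = (∀ e → EqHypHom.hE f e ≡ EqHypHom.hE g e) ×
             (∀ v → EqHypHom.hV f v ≡ EqHypHom.hV g v) ×
             (∀ x → EqHypHom.hQ f x ≡ EqHypHom.hQ g x)

EqHypCat : Category (lsuc lzero) lzero lzero
EqHypCat = record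
  { Obj = EqHyp
  ; _⇒_ = EqHypHom
  ; _≈_ = _≈EqHyp_
  ; id = λ {H} → record
      { hE = λ e → e ; hV = λ v → v ; hQ = λ x → x
      ; s-comm = λ e → map-id (EqHyp.s H e)
      ; t-comm = λ e → map-id (EqHyp.t H e)
      ; q-comm = λ v → refl }
  ; _∘_ = λ {A} g f → record
      { hE = λ e → EqHypHom.hE g (EqHypHom.hE f e)
      ; hV = λ v → EqHypHom.hV g (EqHypHom.hV f v)
      ; hQ = λ x → EqHypHom.hQ g (EqHypHom.hQ f x)
      ; s-comm = λ e → trans (map-∘ (EqHyp.s A e))
          (trans (cong (map (EqHypHom.hV g)) (EqHypHom.s-comm f e))
                 (EqHypHom.s-comm g (EqHypHom.hE f e)))
      ; t-comm = λ e → trans (map-∘ (EqHyp.t A e))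
          (trans (cong (map (EqHypHom.hV g)) (EqHypHom.t-comm f e))
                 (EqHypHom.t-comm g (EqHypHom.hE f e)))
      ; q-comm = λ v → trans (cong (EqHypHom.hQ g) (EqHypHom.q-comm f v))
                             (EqHypHom.q-comm g (EqHypHom.hV f v)) }
  ; equiv = record
      { refl = (λ _ → refl) , (λ _ → refl) , (λ _ → refl)
      ; sym = λ (a , b , c) → (λ x → sym (a x)) , (λ x → sym (b x)) , (λ x → sym (c x))
      ; trans = λ (a , b , c) (a′ , b′ , c′) →
          (λ x → trans (a x) (a′ x)) , (λ x → trans (b x) (b′ x)) ,
          (λ x → trans (c x) (c′ x)) }
  ; ∘-resp-≈ = λ {_} {_} {_} {f} {h} {g} {i} (a , b , c) (a′ , b′ , c′) →
      (λ x → trans (cong (EqHypHom.hE f) (a′ x)) (a (EqHypHom.hE i x))) ,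
      (λ x → trans (cong (EqHypHom.hV f) (b′ x)) (b (EqHypHom.hV i x))) ,
      (λ x → trans (cong (EqHypHom.hQ f) (c′ x)) (c (EqHypHom.hQ i x)))
  ; identityˡ = (λ _ → refl) , (λ _ → refl) , (λ _ → refl)
  ; identityʳ = (λ _ → refl) , (λ _ → refl) , (λ _ → refl)
  ; assoc = (λ _ → refl) , (λ _ → refl) , (λ _ → refl) }

T₀ : EqHyp → Hyp
T₀ H = record { E = EqHyp.E H ; V = EqHyp.V H ; s = EqHyp.s H ; t = EqHyp.t H }

T₁ : ∀ {H H′} → EqHypHom H H′ → HypHom (T₀ H) (T₀ H′)
T₁ h = record
  { hE = EqHypHom.hE h ; hV = EqHypHom.hV h
  ; s-comm = EqHypHom.s-comm h ; t-comm = EqHypHom.t-comm h }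

IsEHyp : EqHyp → Set
IsEHyp H = ∀ e e′ →
  map (EqHyp.q H) (EqHyp.s H e) ≡ map (EqHyp.q H) (EqHyp.s H e′) →
  map (EqHyp.q H) (EqHyp.t H e) ≡ map (EqHyp.q H) (EqHyp.t H e′)

eEqHyp : Category (lsuc lzero) lzero lzero
eEqHyp = FullSub EqHypCat IsEHyp

-- R(H) = (E, V, 1, s, t, !); ! is surjective only if V is inhabited,
-- so R takes a witness of inhabitation (only used for G^Σ, where V = {*}).
R : (H : Hyp) → Hyp.V H → EqHyp
R H v₀ = record
  { E = Hyp.E H ; V = Hyp.V H ; Q = ⊤ ; s = Hyp.s H ; t = Hyp.t H
  ; q = λ _ → tt ; q-surjective = λ _ → v₀ , refl }

record Signature : Set₁ where
  field
    O  : Set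
    ar : O → ℕ

-- G^Σ = (O_Σ, {*}, ar_Σ, γ₁), using {*}⋆ ≅ ℕ via length
GΣ : Signature → Hyp
GΣ Σs = record
  { E = Signature.O Σs ; V = ⊤
  ; s = λ o → replicate (Signature.ar Σs o) tt
  ; t = λ _ → tt ∷ [] }

RGΣ-isEHyp : (Σs : Signature) → IsEHyp (R (GΣ Σs) tt)
RGΣ-isEHyp Σs _ _ _ = refl

RGΣ : Signature → Obj eEqHyp
RGΣ Σs = R (GΣ Σs) tt , RGΣ-isEHyp Σs

module _ (Σs : Signature) where

  record EqHypΣObj : Set₁ where
    field
      H : EqHyp
      l : HypHom (T₀ H) (GΣ Σs)

  EqHypΣHom : EqHypΣObj → EqHypΣObj → Set
  EqHypΣHom A B = Σ (EqHypHom (EqHypΣObj.H A) (EqHypΣObj.H B)) λ h →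
    EqHypΣObj.l A ≈Hyp (EqHypΣObj.l B ∘Hyp T₁ h)

  EqHypΣ : Category (lsuc lzero) lzero lzero
  EqHypΣ = record
    { Obj = EqHypΣObj
    ; _⇒_ = EqHypΣHom
    ; _≈_ = λ f g → proj₁ f ≈EqHyp proj₁ g
    ; id = id EqHypCat , (λ _ → refl) , (λ _ → refl)
    ; _∘_ = λ {A} {B} {C} g f → _∘_ EqHypCat (proj₁ g) (proj₁ f) ,
        (λ e → trans (proj₁ (proj₂ f) e)
                     (proj₁ (proj₂ g) (EqHypHom.hE (proj₁ f) e))) ,
        (λ _ → refl)
    ; equiv = λ {A} {B} → record
        { refl = λ {f} → ≈-refl EqHypCat {f = proj₁ f}
        ; sym = λ {f} {g} → ≈-sym EqHypCat {f = proj₁ f} {g = proj₁ g}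
        ; trans = λ {f} {g} {h} →
            ≈-trans EqHypCat {f = proj₁ f} {g = proj₁ g} {h = proj₁ h} }
    ; ∘-resp-≈ = λ {_} {_} {_} {f} {h} {g} {i} →
        ∘-resp-≈ EqHypCat {f = proj₁ f} {h = proj₁ h} {g = proj₁ g} {i = proj₁ i}
    ; identityˡ = (λ _ → refl) , (λ _ → refl) , (λ _ → refl)
    ; identityʳ = (λ _ → refl) , (λ _ → refl) , (λ _ → refl)
    ; assoc = (λ _ → refl) , (λ _ → refl) , (λ _ → refl) }

  eEqHypΣ : Category (lsuc lzero) lzero lzero
  eEqHypΣ = FullSub EqHypΣ (λ A → IsEHyp (EqHypΣObj.H A))

  WΣ : Functor eEqHypΣ eEqHyp
  WΣ = record
    { F₀ = λ A → EqHypΣObj.H (proj₁ A) , proj₂ A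
    ; F₁ = proj₁
    ; identity = (λ _ → refl) , (λ _ → refl) , (λ _ → refl)
    ; homomorphism = (λ _ → refl) , (λ _ → refl) , (λ _ → refl)
    ; F-resp-≈ = λ p → p }

{-# OPTIONS --safe #-}
-- A labelling T(H) → G^Σ is the same thing as a morphism H → R(G^Σ), since R(G^Σ) has a
-- one-point quotient; so a labelled e-hypergraph is literally an object of the slice over
-- R(G^Σ), and W_Σ is the forgetful functor of that slice.  W_Σ creates colimits: the labels
-- of a diagram form a cocone with apex R(G^Σ), whose mediating morphism labels the colimit,
-- and since colimit legs are jointly epic every mediating morphism respects labels.  It
-- creates pullbacks and equalizers, which are connected limits: the apex is labelled
-- through a leg, and h preserves labels as soon as g ∘ h does for a label-preserving g.
module Submission where

open import Defs
open import Data.Product using (Σ; _×_; _,_; proj₁; proj₂)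
open import Data.Unit using (tt)
open import Level using (0ℓ)
open import Relation.Binary.PropositionalEquality
  using (_≡_; refl; sym; trans; cong; module ≡-Reasoning)

module _ {o ℓ e} (C : Category o ℓ e) where
  open Category C

  colimit-jointly-epic : ∀ {J : Category 0ℓ 0ℓ 0ℓ} {D : Functor J C}
    (K : Cocone C J D) → IsColimit C K →
    ∀ {X} {f g : Cocone.N K ⇒ X} →
    (∀ j → f ∘ Cocone.ψ K j ≈ g ∘ Cocone.ψ K j) → f ≈ g
  colimit-jointly-epic {J} {D} K isColimit {X} {f} {g} agree =
    ≈-trans (unique f agree) (≈-sym (unique g (λ _ → ≈-refl)))
    where
      throughG : Cocone C J D
      throughG = record
        { N = X
        ; ψ = λ j → g ∘ Cocone.ψ K j
        ; commute = λ h → ≈-trans assoc (∘-resp-≈ ≈-refl (Cocone.commute K h)) }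

      unique = proj₂ (proj₂ (isColimit throughG))

R-transpose : ∀ {H} (G : Hyp) (v₀ : Hyp.V G) → HypHom (T₀ H) G → EqHypHom H (R G v₀)
R-transpose G v₀ l = record
  { hE = HypHom.hE l ; hV = HypHom.hV l ; hQ = λ _ → tt
  ; s-comm = HypHom.s-comm l ; t-comm = HypHom.t-comm l
  ; q-comm = λ _ → refl }

pointwise-refl³ : ∀ {A B C D E F : Set} {a : A → B} {c : C → D} {e : E → F} →
  (∀ x → a x ≡ a x) × (∀ x → c x ≡ c x) × (∀ x → e x ≡ e x)
pointwise-refl³ = (λ _ → refl) , (λ _ → refl) , (λ _ → refl)

triangle-cancelʳ : ∀ {A B Z L : Set} {lA : A → L} {lB : B → L} {lZ : Z → L}
  {h : A → B} {g : B → Z} {k : A → Z} →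
  (∀ y → lB y ≡ lZ (g y)) → (∀ x → lA x ≡ lZ (k x)) → (∀ x → g (h x) ≡ k x) →
  ∀ x → lA x ≡ lB (h x)
triangle-cancelʳ {lZ = lZ} {h = h} over-g over-k g∘h≡k x =
  trans (over-k x) (trans (cong lZ (sym (g∘h≡k x))) (sym (over-g (h x))))

module _ (Σs : Signature) where
  private
    C  = eEqHypΣ Σs
    W  = WΣ Σs
    RG = RGΣ Σs
    module C = Category C
    module D = Category eEqHyp
    module E = Category EqHypCat

    carrier : C.Obj → D.Obj
    carrier = Functor.F₀ W

    hypergraph : C.Obj → EqHyp
    hypergraph A = EqHypΣObj.H (proj₁ A)

  open EqHypHom using (hE)

  label : (A : C.Obj) → HypHom (T₀ (hypergraph A)) (GΣ Σs)
  label A = EqHypΣObj.l (proj₁ A)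

  edgeLabel : (A : C.Obj) → EqHyp.E (hypergraph A) → Signature.O Σs
  edgeLabel A = HypHom.hE (label A)

  labelHom : (A : C.Obj) → hypergraph A E.⇒ R (GΣ Σs) tt
  labelHom A = R-transpose (GΣ Σs) tt (label A)

  LabelPreserving : (A B : C.Obj) → carrier A D.⇒ carrier B → Set
  LabelPreserving A B h = label A ≈Hyp (label B ∘Hyp T₁ h)

  -- G^Σ has a single vertex, so only the edge labels carry information.
  edge-label-preserving : ∀ A B (h : carrier A D.⇒ carrier B) →
    (∀ e → edgeLabel A e ≡ edgeLabel B (hE h e)) → LabelPreserving A B h
  edge-label-preserving _ _ _ p = p , λ _ → refl

  preserving⇒over : ∀ A B (h : A C.⇒ B) → labelHom B E.∘ proj₁ h E.≈ labelHom A
  preserving⇒over _ _ (_ , p) = (λ e → sym (proj₁ p e)) , (λ _ → refl) , (λ _ → refl)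

  over⇒preserving : ∀ A B (h : carrier A D.⇒ carrier B) →
    labelHom B E.∘ h E.≈ labelHom A → LabelPreserving A B h
  over⇒preserving A B h o = edge-label-preserving A B h (λ e → sym (proj₁ o e))

  preserving-cancelʳ : ∀ {A B Z} (g : B C.⇒ Z) (k : A C.⇒ Z)
    (h : carrier A D.⇒ carrier B) → proj₁ g E.∘ h E.≈ proj₁ k → LabelPreserving A B h
  preserving-cancelʳ {A} {B} {Z} (g , over-g) (_ , over-k) h g∘h≈k =
    edge-label-preserving A B h
      (triangle-cancelʳ {lZ = edgeLabel Z} {g = hE g}
        (proj₁ over-g) (proj₁ over-k) (proj₁ g∘h≈k))

  labelAlong : ∀ (A : C.Obj) X → X D.⇒ carrier A → C.Obj
  labelAlong A X h = record { H = proj₁ X ; l = label A ∘Hyp T₁ h } , proj₂ X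

  along-preserving : ∀ A X (h : X D.⇒ carrier A) → labelAlong A X h C.⇒ A
  along-preserving A X h = h , edge-label-preserving (labelAlong A X h) A h (λ _ → refl)

  toSlice : Functor C (Slice eEqHyp RG)
  toSlice = record
    { F₀ = λ A → carrier A , labelHom A
    ; F₁ = λ {A} {B} h → proj₁ h , preserving⇒over A B h
    ; identity = pointwise-refl³
    ; homomorphism = pointwise-refl³
    ; F-resp-≈ = λ p → p }

  labelledBy : Category.Obj (Slice eEqHyp RG) → C.Obj
  labelledBy ((X , isE) , f) = record { H = X ; l = T₁ f } , isE

  fromSlice : Functor (Slice eEqHyp RG) C
  fromSlice = record
    { F₀ = labelledBy
    ; F₁ = λ {A} {B} (h , o) → h , over⇒preserving (labelledBy A) (labelledBy B) h o
    ; identity = pointwise-refl³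
    ; homomorphism = pointwise-refl³
    ; F-resp-≈ = λ p → p }

  slice-equivalence : Equivalence C (Slice eEqHyp RG)
  slice-equivalence = record
    { F = toSlice ; G = fromSlice
    ; unit = record
      { η = λ X → C.id {X} ; η⁻¹ = λ X → C.id {X}
      ; iso₁ = λ _ → pointwise-refl³ ; iso₂ = λ _ → pointwise-refl³
      ; natural = λ _ → pointwise-refl³ }
    ; counit = record
      { η = λ X → S.id {X} ; η⁻¹ = λ X → S.id {X}
      ; iso₁ = λ _ → pointwise-refl³ ; iso₂ = λ _ → pointwise-refl³
      ; natural = λ _ → pointwise-refl³ } }
    where module S = Category (Slice eEqHyp RG)

  module _ {J : Category 0ℓ 0ℓ 0ℓ} (Dg : Functor J C) where
    private
      diagram = Functor.F₀ Dg

    labelCocone : Cocone eEqHyp J (W ∘F Dg)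
    labelCocone = record
      { N = RG
      ; ψ = λ j → labelHom (diagram j)
      ; commute = λ f → preserving⇒over (diagram _) (diagram _) (Functor.F₁ Dg f) }

    reflects-colimit : (K : Cocone C J Dg) →
      IsColimit eEqHyp (mapCocone W K) → IsColimit C K
    reflects-colimit K isColimit K′ =
      (u , over⇒preserving (N K) (N K′) u u-over) ,
      factors , λ u′ → unique (proj₁ u′)
      where
        open Cocone
        mediating = isColimit (mapCocone W K′)
        u = proj₁ mediating
        factors = proj₁ (proj₂ mediating)
        unique = proj₂ (proj₂ mediating)

        u-over : labelHom (N K′) E.∘ u E.≈ labelHom (N K)
        u-over = colimit-jointly-epic eEqHyp (mapCocone W K) isColimit
          {X = RG} {labelHom (N K′) E.∘ u} {labelHom (N K)} λ j →
          (λ e → begin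
            edgeLabel (N K′) (hE u (hE (proj₁ (ψ K j)) e))
              ≡⟨ cong (edgeLabel (N K′)) (proj₁ (factors j) e) ⟩
            edgeLabel (N K′) (hE (proj₁ (ψ K′ j)) e)
              ≡⟨ proj₁ (proj₂ (ψ K′ j)) e ⟨
            edgeLabel (diagram j) e
              ≡⟨ proj₁ (proj₂ (ψ K j)) e ⟩
            edgeLabel (N K) (hE (proj₁ (ψ K j)) e)
              ∎) ,
          (λ _ → refl) , (λ _ → refl)
          where open ≡-Reasoning

    lifts-colimit : (L : Cocone eEqHyp J (W ∘F Dg)) → IsColimit eEqHyp L →
      Σ (Cocone C J Dg) λ K → IsColimit C K × IsColimit eEqHyp (mapCocone W K)
    lifts-colimit L isColimit = K , reflects-colimit K isColimit , isColimit
      where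
        mediating = isColimit labelCocone

        apex : C.Obj
        apex = labelledBy (Cocone.N L , proj₁ mediating)

        K : Cocone C J Dg
        K = record
          { N = apex
          ; ψ = λ j → Cocone.ψ L j , over⇒preserving (diagram j) apex (Cocone.ψ L j)
                                         (proj₁ (proj₂ mediating) j)
          ; commute = Cocone.commute L }

  creates-colimits : CreatesColimits W
  creates-colimits _ Dg = reflects-colimit Dg , lifts-colimit Dg

  creates-pullbacks : CreatesPullbacks W
  creates-pullbacks {A} {B} {Z} f g = reflects , lifts
    where
      open Square

      reflects : (S : Square C f g) → IsPullback eEqHyp (mapSquare W S) → IsPullback C S
      reflects S isPullback S′ =
        (u , preserving-cancelʳ {P S′} {P S} {A} (p₁ S) (p₁ S′) u factors₁) ,
        factors₁ , factors₂ , λ u′ → unique (proj₁ u′)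
        where
          mediating = isPullback (mapSquare W S′)
          u = proj₁ mediating
          factors₁ = proj₁ (proj₂ mediating)
          factors₂ = proj₁ (proj₂ (proj₂ mediating))
          unique = proj₂ (proj₂ (proj₂ mediating))

      lifts : (S′ : Square eEqHyp (proj₁ f) (proj₁ g)) → IsPullback eEqHyp S′ →
        Σ (Square C f g) λ S → IsPullback C S × IsPullback eEqHyp (mapSquare W S)
      lifts S′ isPullback = S , reflects S isPullback , isPullback
        where
          apex = labelAlong A (P S′) (p₁ S′)
          leg₁ = along-preserving A (P S′) (p₁ S′)

          g∘p₂≈f∘p₁ : proj₁ g E.∘ p₂ S′ E.≈ proj₁ f E.∘ p₁ S′
          g∘p₂≈f∘p₁ = E.≈-sym {f = proj₁ f E.∘ p₁ S′} {proj₁ g E.∘ p₂ S′} (commute S′)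

          S : Square C f g
          S = record
            { P = apex
            ; p₁ = leg₁
            ; p₂ = p₂ S′ , preserving-cancelʳ {apex} {B} {Z}
                             g (C._∘_ {apex} {A} {Z} f leg₁) (p₂ S′) g∘p₂≈f∘p₁
            ; commute = commute S′ }

  creates-equalizers : CreatesEqualizers W
  creates-equalizers {A} f g = reflects , lifts
    where
      open Fork

      reflects : (K : Fork C f g) → IsEqualizer eEqHyp (mapFork W K) → IsEqualizer C K
      reflects K isEqualizer K′ =
        (u , preserving-cancelʳ {Eo K′} {Eo K} {A} (ι K) (ι K′) u factors) ,
        factors , λ u′ → unique (proj₁ u′)
        where
          mediating = isEqualizer (mapFork W K′)
          u = proj₁ mediating
          factors = proj₁ (proj₂ mediating)
          unique = proj₂ (proj₂ mediating)

      lifts : (K′ : Fork eEqHyp (proj₁ f) (proj₁ g)) → IsEqualizer eEqHyp K′ →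
        Σ (Fork C f g) λ K → IsEqualizer C K × IsEqualizer eEqHyp (mapFork W K)
      lifts K′ isEqualizer = K , reflects K isEqualizer , isEqualizer
        where
          K : Fork C f g
          K = record
            { Eo = labelAlong A (Eo K′) (ι K′)
            ; ι = along-preserving A (Eo K′) (ι K′)
            ; commute = commute K′ }

proposition5p9 : (Σs : Signature) →
    Equivalence (eEqHypΣ Σs) (Slice eEqHyp (RGΣ Σs)) ×
    (CreatesColimits (WΣ Σs) × CreatesPullbacks (WΣ Σs) × CreatesEqualizers (WΣ Σs))
proposition5p9 Σs =
  slice-equivalence Σs ,
  creates-colimits Σs , creates-pullbacks Σs , creates-equalizers Σs
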